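{- Let $\Sigma$ be a finite alphabet, let $\Gamma$ consist of $T_1[s]$ together with all instances $\mathrm{Ind}[Z,P,s]$ of the induction principle for first-order formulas $Z,P$ over $vocab(\Sigma)$, and let $\phi$ be a first-order sentence over $vocab(\Sigma)$. If some structure $\mathcal{B}$ satisfies $\Gamma\cup\{A_{\Sigma w}\}\cup\{\phi\}$, then there exists a (finite, nonempty) word $w_0$ over $\Sigma$ whose word model satisfies $\phi$.
   Context: $vocab(\Sigma)$ consists of constants $0,max$, binary relation symbols $s$ and $s^*$, and unary relation symbols $P_\sigma$ for $\sigma\in\Sigma$. $A_{\Sigma w}$ is the conjunction of: (A1) $\forall x\,.\,(\lnot s(x,0)\land\lnot s(max,x)\land(x\neq0\rightarrow\exists y\,.\,s(y,x))\land(x\neq max\rightarrow\exists y\,.\,s(x,y)))$; (A2) $\forall x,y,z\,.\,((s(x,y)\land s(x,z))\lor(s(y,x)\land s(z,x)))\rightarrow y=z$; (A3) $\forall x\,.\,s^*(0,x)\land s^*(x,max)$; (A4) $\forall x\,.\,\bigvee_{\sigma\in\Sigma}(P_\sigma(x)\land\bigwedge_{\tau\neq\sigma}\lnot P_\tau(x))$. A word model of a nonempty word $\sigma_0\cdots\sigma_{n-1}$ has universe $\{0,\dots,n-1\}$, $0\mapsto 0$, $max\mapsto n-1$, $s=\{(i,i+1)\}$, $s^*=\le$, $P_\sigma=\{i:\sigma_i=\sigma\}$. $T_1[s]\equiv\forall u,v\,.\,s^*(u,v)\leftrightarrow((u=v)\lor\exists w\,.\,s(u,w)\land s^*(w,v))$.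 $\mathrm{Ind}[Z,P,s]\equiv[(\forall w\,.\,Z(w)\rightarrow P(w))\land(\forall u,v\,.\,P(u)\land s(u,v)\rightarrow P(v))]\rightarrow\forall u,w\,.\,Z(w)\land s^*(w,u)\rightarrow P(u)$, where $Z(u),P(u)$ may contain further free variables over which the instance is universally closed. -}

module Defs where

open import Data.Nat using (ℕ; zero; suc)
open import Data.Fin using (Fin; zero; suc; toℕ; fromℕ; _≤_)
open import Data.Fin using (_≟_)
open import Data.List using (List; []; _∷_; foldr)
open import Data.List using (allFin)
open import Data.Product using (Σ; _×_; _,_)
open import Data.Sum using (_⊎_)
open import Data.Empty using (⊥)
open import Relation.Nullary using (¬_; yes; no; Dec)
open import Relation.Binary.PropositionalEquality using (_≡_)

-- The vocabulary vocab(Σ) for the finite alphabet Σ = Fin k.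
-- Terms and first-order formulas with n free (de Bruijn) variables;
-- var zero is the most recently bound variable.

data Term (n : ℕ) : Set where
  var  : Fin n → Term n
  c0   : Term n
  cmax : Term n

data Formula (k : ℕ) : ℕ → Set where
  s    : ∀ {n} → Term n → Term n → Formula k n
  s*   : ∀ {n} → Term n → Term n → Formula k n
  P    : ∀ {n} → Fin k → Term n → Formula k n
  _≐_  : ∀ {n} → Term n → Term n → Formula k n
  ⊥'   : ∀ {n} → Formula k n
  ¬'_  : ∀ {n} → Formula k n → Formula k n
  _∧'_ : ∀ {n} → Formula k n → Formula k n → Formula k n
  _∨'_ : ∀ {n} → Formula k n → Formula k n → Formula k n
  _⇒_  : ∀ {n} → Formula k n → Formula k n → Formula k n
  ∀'   : ∀ {n} → Formula k (suc n) → Formula k n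
  ∃'   : ∀ {n} → Formula k (suc n) → Formula k n

infix  8 _≐_
infix  7 ¬'_
infixr 6 _∧'_
infixr 5 _∨'_
infixr 4 _⇒_ _⇔_

Sentence : ℕ → Set
Sentence k = Formula k 0

⊤' : ∀ {k n} → Formula k n
⊤' = ¬' ⊥'

_⇔_ : ∀ {k n} → Formula k n → Formula k n → Formula k n
φ ⇔ ψ = (φ ⇒ ψ) ∧' (ψ ⇒ φ)

⋀ : ∀ {k n} → List (Formula k n) → Formula k n
⋀ = foldr _∧'_ ⊤'

⋁ : ∀ {k n} → List (Formula k n) → Formula k n
⋁ = foldr _∨'_ ⊥'

mapL : ∀ {A B : Set} → (A → B) → List A → List B
mapL f [] = []
mapL f (x ∷ xs) = f x ∷ mapL f xs

ext : ∀ {n m} → (Fin n → Fin m) → Fin (suc n) → Fin (suc m)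
ext ρ zero = zero
ext ρ (suc i) = suc (ρ i)

renT : ∀ {n m} → (Fin n → Fin m) → Term n → Term m
renT ρ (var i) = var (ρ i)
renT ρ c0 = c0
renT ρ cmax = cmax

ren : ∀ {k n m} → (Fin n → Fin m) → Formula k n → Formula k m
ren ρ (s t u) = s (renT ρ t) (renT ρ u)
ren ρ (s* t u) = s* (renT ρ t) (renT ρ u)
ren ρ (P σ t) = P σ (renT ρ t)
ren ρ (t ≐ u) = renT ρ t ≐ renT ρ u
ren ρ ⊥' = ⊥'
ren ρ (¬' φ) = ¬' ren ρ φ
ren ρ (φ ∧' ψ) = ren ρ φ ∧' ren ρ ψ
ren ρ (φ ∨' ψ) = ren ρ φ ∨' ren ρ ψ
ren ρ (φ ⇒ ψ) = ren ρ φ ⇒ ren ρ ψ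
ren ρ (∀' φ) = ∀' (ren (ext ρ) φ)
ren ρ (∃' φ) = ∃' (ren (ext ρ) φ)

closeAll : ∀ {k m} → Formula k m → Sentence k
closeAll {m = zero} φ = φ
closeAll {m = suc m} φ = closeAll (∀' φ)

record Structure (k : ℕ) : Set₁ where
  field
    U     : Set
    zeroU : U
    maxU  : U
    S     : U → U → Set
    S*    : U → U → Set
    Pr    : Fin k → U → Set

_∷ᵉ_ : ∀ {A : Set} {n} → A → (Fin n → A) → Fin (suc n) → A
(a ∷ᵉ ρ) zero = a
(a ∷ᵉ ρ) (suc i) = ρ i

module _ {k : ℕ} (B : Structure k) where
  open Structure B

  evalT : ∀ {n} → (Fin n → U) → Term n → U
  evalT ρ (var i) = ρ i
  evalT ρ c0 = zeroU
  evalT ρ cmax = maxU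

  ⟦_⟧ : ∀ {n} → Formula k n → (Fin n → U) → Set
  ⟦ s t u ⟧ ρ = S (evalT ρ t) (evalT ρ u)
  ⟦ s* t u ⟧ ρ = S* (evalT ρ t) (evalT ρ u)
  ⟦ P σ t ⟧ ρ = Pr σ (evalT ρ t)
  ⟦ t ≐ u ⟧ ρ = evalT ρ t ≡ evalT ρ u
  ⟦ ⊥' ⟧ ρ = ⊥
  ⟦ ¬' φ ⟧ ρ = ¬ ⟦ φ ⟧ ρ
  ⟦ φ ∧' ψ ⟧ ρ = ⟦ φ ⟧ ρ × ⟦ ψ ⟧ ρ
  ⟦ φ ∨' ψ ⟧ ρ = ⟦ φ ⟧ ρ ⊎ ⟦ ψ ⟧ ρ
  ⟦ φ ⇒ ψ ⟧ ρ = ⟦ φ ⟧ ρ → ⟦ ψ ⟧ ρ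
  ⟦ ∀' φ ⟧ ρ = (a : U) → ⟦ φ ⟧ (a ∷ᵉ ρ)
  ⟦ ∃' φ ⟧ ρ = Σ U λ a → ⟦ φ ⟧ (a ∷ᵉ ρ)

  emptyEnv : Fin 0 → U
  emptyEnv ()

_⊨_ : ∀ {k} → Structure k → Sentence k → Set
B ⊨ φ = ⟦ B ⟧ φ (emptyEnv B)

private
  v0 : ∀ {n} → Term (suc n)
  v0 = var zero
  v1 : ∀ {n} → Term (suc (suc n))
  v1 = var (suc zero)
  v2 : ∀ {n} → Term (suc (suc (suc n)))
  v2 = var (suc (suc zero))

A1 : ∀ {k} → Sentence k
A1 = ∀' ( ¬' s v0 c0
        ∧' ¬' s cmax v0
        ∧' (¬' (v0 ≐ c0) ⇒ ∃' (s v0 v1))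
        ∧' (¬' (v0 ≐ cmax) ⇒ ∃' (s v1 v0)))

A2 : ∀ {k} → Sentence k
A2 = ∀' (∀' (∀' ((s v2 v1 ∧' s v2 v0) ∨' (s v1 v2 ∧' s v0 v2) ⇒ v1 ≐ v0)))

A3 : ∀ {k} → Sentence k
A3 = ∀' (s* c0 v0 ∧' s* v0 cmax)

notOthers : ∀ {k} → Fin k → Formula k 1
notOthers {k} σ = ⋀ (mapL (λ τ → f τ (τ ≟ σ)) (allFin k))
  where
  f : (τ : Fin k) → Dec (τ ≡ σ) → Formula k 1
  f τ (yes _) = ⊤'
  f τ (no _)  = ¬' P τ v0

A4 : ∀ {k} → Sentence k
A4 {k} = ∀' (⋁ (mapL (λ σ → P σ v0 ∧' notOthers σ) (allFin k)))

AΣw : ∀ {k} → Sentence k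
AΣw = A1 ∧' A2 ∧' A3 ∧' A4

T1 : ∀ {k} → Sentence k
T1 = ∀' (∀' (s* v1 v0 ⇔ (v1 ≐ v0 ∨' ∃' (s v2 v0 ∧' s* v0 v1))))

-- In context (u, w, params) resp. (u, v, params) with var 0 = second,
-- var 1 = first bound variable: substitute the distinguished variable of
-- a formula Z(x; params) by var 0 or by var 1.
at0 : ∀ {m} → Fin (suc m) → Fin (suc (suc m))
at0 zero = zero
at0 (suc i) = suc (suc i)

at1 : ∀ {m} → Fin (suc m) → Fin (suc (suc m))
at1 zero = suc zero
at1 (suc i) = suc (suc i)

-- Ind[Z,P,s] for Z(x), P(x) with m further free variables (parameters);
-- x is var zero of Z and P.
Ind : ∀ {k m} → Formula k (suc m) → Formula k (suc m) → Formula k m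
Ind Z Pf =
  ( ∀' (Z ⇒ Pf)
    ∧' ∀' (∀' (ren at1 Pf ∧' s v1 v0 ⇒ ren at0 Pf)) )
  ⇒ ∀' (∀' (ren at0 Z ∧' s* v0 v1 ⇒ ren at1 Pf))

InΓ : ∀ {k} → Sentence k → Set
InΓ {k} ψ = (ψ ≡ T1) ⊎
  Σ ℕ λ m → Σ (Formula k (suc m)) λ Z → Σ (Formula k (suc m)) λ Pf →
    ψ ≡ closeAll (Ind Z Pf)

-- Word models of nonempty words σ_0 ⋯ σ_n (length suc n) over Fin k.

wordModel : ∀ {k n} → (Fin (suc n) → Fin k) → Structure k
wordModel {k} {n} w = record
  { U     = Fin (suc n)
  ; zeroU = zero
  ; maxU  = fromℕ n
  ; S     = λ i j → toℕ j ≡ suc (toℕ i)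
  ; S*    = λ i j → i ≤ j
  ; Pr    = λ σ i → w i ≡ σ
  }

-- Fix q = qr φ and compare B with word models through rank-q types. With excluded middle a rank-q
-- type is a finite datum, characterised by its Hintikka formula, and there are finitely many of them.
-- For x in B let B↾x be the initial segment {y | s*(y,x)}. "B↾x has the rank-q type of some word
-- model" is then a first-order property of x (a finite disjunction of relativised Hintikka formulas),
-- so the induction schema of Γ applies along s from 0. B↾0 is a single point, like a one-letter word.
-- If s(u,v), then B↾v is B↾u with one new last point carrying the letter of v, and appending a last
-- point with the same letter to two structures preserves equality of their rank-q types (an
-- Ehrenfeucht–Fraïssé argument). Hence B↾max, which is B itself, has the rank-q type of a word model,
-- and that word model satisfies φ.

module Submission where

open import Defs hiding (_⇔_)
open import Data.Bool using (Bool; true; false)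
open import Data.Bool.Properties using (T-irrelevant)
open import Data.Empty using (⊥; ⊥-elim)
open import Data.Fin as Fin using (Fin; zero; suc; toℕ; fromℕ; inject₁)
open import Data.Fin.Properties using (toℕ-injective; toℕ-fromℕ; toℕ-inject₁; toℕ<n; ≤fromℕ; inject₁-injective; inject₁ℕ<; fromℕ≢inject₁)
open import Data.Fin.Relation.Unary.Top using (view; ‵fromℕ; ‵inj₁; view-inject₁; view-fromℕ)
open import Data.List using (List; []; _∷_; _++_; map; length; allFin; cartesianProduct; cartesianProductWith; filter)
open import Data.List.Membership.Propositional using (_∈_)
open import Data.List.Membership.Propositional.Properties using (∈-allFin; ∈-map⁺; ∈-++⁺ˡ; ∈-++⁺ʳ; ∈-cartesianProductWith⁺; ∈-cartesianProduct⁺; ∈-filter⁺; ∈-filter⁻)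
open import Data.List.Relation.Unary.Any using (here; there)
open import Data.Nat as ℕ using (ℕ; zero; suc; _⊔_; s≤s)
open import Data.Nat.Properties using (≤-refl; m⊔n≤o⇒m≤o; m⊔n≤o⇒n≤o; suc-injective; <⇒≢; <⇒≱)
open import Data.Product using (Σ; _×_; _,_; proj₁; proj₂; uncurry)
open import Data.Product.Properties using (×-≡,≡↔≡)
open import Data.Product.Function.NonDependent.Propositional using (_×-cong_)
open import Data.Sum using (_⊎_; inj₁; inj₂)
open import Data.Sum.Function.Propositional using (_⊎-cong_)
open import Data.Unit using (⊤; tt)
open import Data.Vec using (Vec; []; _∷_)
open import Data.Vec.Properties using (∷-injective)
open import Function.Base using (id)
open import Function.Bundles using (_⇔_; mk⇔; Equivalence)
open import Function.Properties.Equivalence using () renaming (refl to ⇔-refl; sym to ⇔-sym; trans to ⇔-trans)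
open import Function.Properties.Inverse using (↔⇒⇔)
open import Function.Related.TypeIsomorphisms using (→-cong-⇔; ¬-cong-⇔)
open import Relation.Nullary using (¬_; Dec; yes; no; does)
open import Relation.Nullary.Decidable using (fromSum; True; toWitness; fromWitness; dec-true; does-⇔)
open import Relation.Binary.PropositionalEquality

open Equivalence using (to; from)

resp-⇔ : {X : Set} (R : X → Set) {x x' : X} → x ≡ x' → R x ⇔ R x'
resp-⇔ R refl = ⇔-refl

resp₂-⇔ : {X Y : Set} (R : X → Y → Set) {x x' : X} {y y' : Y} → x ≡ x' → y ≡ y' → R x y ⇔ R x' y'
resp₂-⇔ R refl refl = ⇔-refl

Π-cong-⇔ : {A : Set} {P Q : A → Set} → (∀ a → P a ⇔ Q a) → ((a : A) → P a) ⇔ ((a : A) → Q a)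
Π-cong-⇔ e = mk⇔ (λ h a → to (e a) (h a)) (λ h a → from (e a) (h a))

Σ-cong-⇔ : {A : Set} {P Q : A → Set} → (∀ a → P a ⇔ Q a) → Σ A P ⇔ Σ A Q
Σ-cong-⇔ e = mk⇔ (λ (a , p) → a , to (e a) p) (λ (a , q) → a , from (e a) q)

-- Semantics of renaming, universal closure and induction

module _ {k : ℕ} (M : Structure k) where
  open Structure M

  evalT-cong : ∀ {n} {η η' : Fin n → U} → (∀ i → η i ≡ η' i) → ∀ t → evalT M η t ≡ evalT M η' t
  evalT-cong e (var i) = e i
  evalT-cong e c0 = refl
  evalT-cong e cmax = refl

  ∷ᵉ-cong : ∀ {n} {η η' : Fin n → U} a → (∀ i → η i ≡ η' i) → ∀ i → (a ∷ᵉ η) i ≡ (a ∷ᵉ η') i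
  ∷ᵉ-cong a e zero = refl
  ∷ᵉ-cong a e (suc i) = e i

  ⟦⟧-cong : ∀ {n} (φ : Formula k n) {η η' : Fin n → U} → (∀ i → η i ≡ η' i) → ⟦ M ⟧ φ η ⇔ ⟦ M ⟧ φ η'
  ⟦⟧-cong (s t u) e = resp₂-⇔ S (evalT-cong e t) (evalT-cong e u)
  ⟦⟧-cong (s* t u) e = resp₂-⇔ S* (evalT-cong e t) (evalT-cong e u)
  ⟦⟧-cong (P σ t) e = resp-⇔ (Pr σ) (evalT-cong e t)
  ⟦⟧-cong (t ≐ u) e = resp₂-⇔ _≡_ (evalT-cong e t) (evalT-cong e u)
  ⟦⟧-cong ⊥' e = ⇔-refl
  ⟦⟧-cong (¬' φ) e = ¬-cong-⇔ (⟦⟧-cong φ e)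
  ⟦⟧-cong (φ ∧' ψ) e = ⟦⟧-cong φ e ×-cong ⟦⟧-cong ψ e
  ⟦⟧-cong (φ ∨' ψ) e = ⟦⟧-cong φ e ⊎-cong ⟦⟧-cong ψ e
  ⟦⟧-cong (φ ⇒ ψ) e = →-cong-⇔ (⟦⟧-cong φ e) (⟦⟧-cong ψ e)
  ⟦⟧-cong (∀' φ) e = Π-cong-⇔ λ a → ⟦⟧-cong φ (∷ᵉ-cong a e)
  ⟦⟧-cong (∃' φ) e = Σ-cong-⇔ λ a → ⟦⟧-cong φ (∷ᵉ-cong a e)

  evalT-ren : ∀ {n m} (ρ : Fin n → Fin m) {η : Fin n → U} {η' : Fin m → U} →
              (∀ i → η' (ρ i) ≡ η i) → ∀ t → evalT M η' (renT ρ t) ≡ evalT M η t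
  evalT-ren ρ e (var i) = e i
  evalT-ren ρ e c0 = refl
  evalT-ren ρ e cmax = refl

  ∷ᵉ-ext : ∀ {n m} (ρ : Fin n → Fin m) {η : Fin n → U} {η' : Fin m → U} a →
           (∀ i → η' (ρ i) ≡ η i) → ∀ i → (a ∷ᵉ η') (ext ρ i) ≡ (a ∷ᵉ η) i
  ∷ᵉ-ext ρ a e zero = refl
  ∷ᵉ-ext ρ a e (suc i) = e i

  ⟦ren⟧ : ∀ {n m} (ρ : Fin n → Fin m) (φ : Formula k n) {η : Fin n → U} {η' : Fin m → U} →
          (∀ i → η' (ρ i) ≡ η i) → ⟦ M ⟧ (ren ρ φ) η' ⇔ ⟦ M ⟧ φ η
  ⟦ren⟧ ρ (s t u) e = resp₂-⇔ S (evalT-ren ρ e t) (evalT-ren ρ e u)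
  ⟦ren⟧ ρ (s* t u) e = resp₂-⇔ S* (evalT-ren ρ e t) (evalT-ren ρ e u)
  ⟦ren⟧ ρ (P σ t) e = resp-⇔ (Pr σ) (evalT-ren ρ e t)
  ⟦ren⟧ ρ (t ≐ u) e = resp₂-⇔ _≡_ (evalT-ren ρ e t) (evalT-ren ρ e u)
  ⟦ren⟧ ρ ⊥' e = ⇔-refl
  ⟦ren⟧ ρ (¬' φ) e = ¬-cong-⇔ (⟦ren⟧ ρ φ e)
  ⟦ren⟧ ρ (φ ∧' ψ) e = ⟦ren⟧ ρ φ e ×-cong ⟦ren⟧ ρ ψ e
  ⟦ren⟧ ρ (φ ∨' ψ) e = ⟦ren⟧ ρ φ e ⊎-cong ⟦ren⟧ ρ ψ e
  ⟦ren⟧ ρ (φ ⇒ ψ) e = →-cong-⇔ (⟦ren⟧ ρ φ e) (⟦ren⟧ ρ ψ e)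
  ⟦ren⟧ ρ (∀' φ) e = Π-cong-⇔ λ a → ⟦ren⟧ (ext ρ) φ (∷ᵉ-ext ρ a e)
  ⟦ren⟧ ρ (∃' φ) e = Σ-cong-⇔ λ a → ⟦ren⟧ (ext ρ) φ (∷ᵉ-ext ρ a e)

  ⊨closeAll : ∀ {m} (φ : Formula k m) → M ⊨ closeAll φ → ∀ η → ⟦ M ⟧ φ η
  ⊨closeAll {zero} φ h η = to (⟦⟧-cong φ (λ ())) h
  ⊨closeAll {suc m} φ h η =
    to (⟦⟧-cong φ λ { zero → refl ; (suc i) → refl }) (⊨closeAll (∀' φ) h (λ i → η (suc i)) (η zero))

  ⟦Ind⟧ : ∀ {m} (Z Q : Formula k (suc m)) (η : Fin m → U) → ⟦ M ⟧ (Ind Z Q) η →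
          (∀ w → ⟦ M ⟧ Z (w ∷ᵉ η) → ⟦ M ⟧ Q (w ∷ᵉ η)) →
          (∀ u v → ⟦ M ⟧ Q (u ∷ᵉ η) → S u v → ⟦ M ⟧ Q (v ∷ᵉ η)) →
          ∀ {w u} → ⟦ M ⟧ Z (w ∷ᵉ η) → S* w u → ⟦ M ⟧ Q (u ∷ᵉ η)
  ⟦Ind⟧ Z Q η ind base step {w} {u} zw wu =
    to (⟦at1⟧ Q) (ind (base , λ a b (Qa , ab) → from (⟦at0⟧ Q) (step a b (to (⟦at1⟧ Q) Qa) ab))
                      u w (from (⟦at0⟧ Z) zw , wu))
    where
    ⟦at0⟧ : ∀ φ {a b} → ⟦ M ⟧ (ren at0 φ) (b ∷ᵉ (a ∷ᵉ η)) ⇔ ⟦ M ⟧ φ (b ∷ᵉ η)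
    ⟦at0⟧ φ = ⟦ren⟧ at0 φ λ { zero → refl ; (suc i) → refl }
    ⟦at1⟧ : ∀ φ {a b} → ⟦ M ⟧ (ren at1 φ) (b ∷ᵉ (a ∷ᵉ η)) ⇔ ⟦ M ⟧ φ (a ∷ᵉ η)
    ⟦at1⟧ φ = ⟦ren⟧ at1 φ λ { zero → refl ; (suc i) → refl }

  ⟦⋁⟧⁻ : ∀ {n} {A : Set} (f : A → Formula k n) (L : List A) {η : Fin n → U} →
         ⟦ M ⟧ (⋁ (mapL f L)) η → Σ A λ x → x ∈ L × ⟦ M ⟧ (f x) η
  ⟦⋁⟧⁻ f (x ∷ L) (inj₁ h) = x , here refl , h
  ⟦⋁⟧⁻ f (x ∷ L) (inj₂ h) with ⟦⋁⟧⁻ f L h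
  ... | y , y∈L , h' = y , there y∈L , h'

  ⟦⋁⟧⁺ : ∀ {n} {A : Set} (f : A → Formula k n) {L : List A} {η : Fin n → U} {x} →
         x ∈ L → ⟦ M ⟧ (f x) η → ⟦ M ⟧ (⋁ (mapL f L)) η
  ⟦⋁⟧⁺ f (here refl) h = inj₁ h
  ⟦⋁⟧⁺ f (there x∈L) h = inj₂ (⟦⋁⟧⁺ f x∈L h)

  ⟦⋀⟧⁻ : ∀ {n} {A : Set} (f : A → Formula k n) {L : List A} {η : Fin n → U} {x} →
         ⟦ M ⟧ (⋀ (mapL f L)) η → x ∈ L → ⟦ M ⟧ (f x) η
  ⟦⋀⟧⁻ f (h , _) (here refl) = h
  ⟦⋀⟧⁻ f (_ , h) (there x∈L) = ⟦⋀⟧⁻ f h x∈L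

-- Models of Γ ∪ {A_Σw}

module ModelOfΓ {k : ℕ} (B : Structure k) (Γ⊨ : ∀ ψ → InΓ ψ → B ⊨ ψ) (A⊨ : B ⊨ AΣw) where
  open Structure B

  ∅ : Fin 0 → U
  ∅ = emptyEnv B

  T1⊨ : B ⊨ T1
  T1⊨ = Γ⊨ T1 (inj₁ refl)

  A1⊨ : B ⊨ A1
  A1⊨ = proj₁ A⊨

  A2⊨ : B ⊨ A2
  A2⊨ = proj₁ (proj₂ A⊨)

  A3⊨ : B ⊨ A3
  A3⊨ = proj₁ (proj₂ (proj₂ A⊨))

  A4⊨ : B ⊨ A4
  A4⊨ = proj₂ (proj₂ (proj₂ A⊨))

  S*-intro : ∀ u v → u ≡ v ⊎ Σ U (λ w → S u w × S* w v) → S* u v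
  S*-intro u v = proj₂ (T1⊨ u v)

  ind : ∀ {m} (Z Q : Formula k (suc m)) (η : Fin m → U) → ⟦ B ⟧ (Ind Z Q) η
  ind {m} Z Q = ⊨closeAll B (Ind Z Q) (Γ⊨ _ (inj₂ (m , Z , Q , refl)))

  ¬S-zero : ∀ x → ¬ S x zeroU
  ¬S-zero x = proj₁ (A1⊨ x)

  S-injectiveˡ : ∀ {x y z} → S y x → S z x → y ≡ z
  S-injectiveˡ {x} {y} {z} yx zx = A2⊨ x y z (inj₂ (yx , zx))

  zero-S* : ∀ x → S* zeroU x
  zero-S* x = proj₁ (A3⊨ x)

  S*-max : ∀ x → S* x maxU
  S*-max x = proj₂ (A3⊨ x)

  S*-refl : ∀ a → S* a a
  S*-refl a = S*-intro a a (inj₁ refl)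

  S-S*-trans : ∀ {a b c} → S a b → S* b c → S* a c
  S-S*-trans {a} {b} {c} ab bc = S*-intro a c (inj₂ (b , ab , bc))

  S⇒S* : ∀ {a b} → S a b → S* a b
  S⇒S* ab = S-S*-trans ab (S*-refl _)

  S*-trans : ∀ {a b c} → S* a b → S* b c → S* a c
  S*-trans {a} {b} {c} ab bc =
    ⟦Ind⟧ B Z Q (a ∷ᵉ ∅) (ind Z Q (a ∷ᵉ ∅))
      (λ { w refl c' → id })
      (λ u v Qu uv c' vc' → Qu c' (S-S*-trans uv vc'))
      refl ab c bc
    where
    Z Q : Formula k 2
    Z = var zero ≐ var (suc zero)
    Q = ∀' (s* (var (suc zero)) (var zero) ⇒ s* (var (suc (suc zero))) (var zero))

  S*-unsnoc : ∀ {w u} → S* w u → u ≡ w ⊎ Σ U λ p → S p u × S* w p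
  S*-unsnoc {w} {u} wu =
    ⟦Ind⟧ B Z Q (w ∷ᵉ ∅) (ind Z Q (w ∷ᵉ ∅))
      (λ _ eq → inj₁ eq)
      (λ u' v' Qu' u'v' → inj₂ (u' , u'v' , unsnoc⁻ Qu'))
      refl wu
    where
    Z Q : Formula k 2
    Z = var zero ≐ var (suc zero)
    Q = (var zero ≐ var (suc zero)) ∨' ∃' (s (var zero) (var (suc zero)) ∧' s* (var (suc (suc zero))) (var zero))
    unsnoc⁻ : ∀ {u'} → u' ≡ w ⊎ Σ U (λ p → S p u' × S* w p) → S* w u'
    unsnoc⁻ (inj₁ refl) = S*-refl _
    unsnoc⁻ (inj₂ (p , pu' , wp)) = S*-trans wp (S⇒S* pu')

  S*-zero : ∀ {y} → S* y zeroU → y ≡ zeroU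
  S*-zero y0 with S*-unsnoc y0
  ... | inj₁ eq = sym eq
  ... | inj₂ (p , p0 , _) = ⊥-elim (¬S-zero p p0)

  S*-into-successor : ∀ {y u v} → S* y v → S u v → y ≡ v ⊎ S* y u
  S*-into-successor yv uv with S*-unsnoc yv
  ... | inj₁ eq = inj₁ (sym eq)
  ... | inj₂ (p , pv , yp) = inj₂ (subst (S* _) (S-injectiveˡ pv uv) yp)

  S-acyclic : ∀ {x w} → S x w → ¬ S* w x
  S-acyclic {x} {w} xw wx =
    ⟦Ind⟧ B Z Q ∅ (ind Z Q ∅)
      (λ { _ refl (w' , 0w' , w'0) → ¬S-zero zeroU (subst (S zeroU) (S*-zero w'0) 0w') })
      step
      refl (zero-S* x) (w , xw , wx)
    where
    Z Q : Formula k 1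
    Z = var zero ≐ c0
    Q = ¬' ∃' (s (var (suc zero)) (var zero) ∧' s* (var zero) (var (suc zero)))
    step : ∀ u v → ¬ Σ U (λ w → S u w × S* w u) → S u v → ¬ Σ U (λ w → S v w × S* w v)
    step u v no-cycle uv (w' , vw' , w'v) with S*-into-successor w'v uv
    ... | inj₁ refl = no-cycle (u , subst (S u) (S-injectiveˡ vw' uv) uv , S*-refl u)
    ... | inj₂ w'u = no-cycle (v , uv , S-S*-trans vw' w'u)

  S-irrefl : ∀ {x} → ¬ S x x
  S-irrefl xx = S-acyclic xx (S*-refl _)

  letter : ∀ x → Σ (Fin k) λ σ → Pr σ x × (∀ τ → Pr τ x → τ ≡ σ)
  letter x with ⟦⋁⟧⁻ B _ (allFin k) (A4⊨ x)
  ... | σ , _ , (σx , others) = σ , σx , unique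
    where
    unique : ∀ τ → Pr τ x → τ ≡ σ
    unique τ τx with τ Fin.≟ σ | ⟦⋀⟧⁻ B _ others (∈-allFin τ)
    ... | yes τ≡σ | _ = τ≡σ
    ... | no _ | ¬τx = ⊥-elim (¬τx τx)

  label : U → Fin k
  label x = proj₁ (letter x)

  Pr⇔label : ∀ τ x → Pr τ x ⇔ label x ≡ τ
  Pr⇔label τ x = mk⇔ (λ τx → sym (proj₂ (proj₂ (letter x)) τ τx)) λ { refl → proj₁ (proj₂ (letter x)) }

-- Atoms, quantifier rank and back-and-forth systems

data Atom (k n : ℕ) : Set where
  sᵃ s*ᵃ _≐ᵃ_ : Term n → Term n → Atom k n
  Pᵃ : Fin k → Term n → Atom k n

atom : ∀ {k n} → Atom k n → Formula k n
atom (sᵃ t u) = s t u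
atom (s*ᵃ t u) = s* t u
atom (t ≐ᵃ u) = t ≐ u
atom (Pᵃ σ t) = P σ t

terms : ∀ n → List (Term n)
terms n = c0 ∷ cmax ∷ map var (allFin n)

∈-terms : ∀ {n} (t : Term n) → t ∈ terms n
∈-terms c0 = here refl
∈-terms cmax = there (here refl)
∈-terms (var i) = there (there (∈-map⁺ var (∈-allFin i)))

termPairs : ∀ {A : Set} {n} → (Term n → Term n → A) → List A
termPairs {n = n} f = cartesianProductWith f (terms n) (terms n)

∈-termPairs : ∀ {A : Set} {n} (f : Term n → Term n → A) t u → f t u ∈ termPairs f
∈-termPairs f t u = ∈-cartesianProductWith⁺ f (∈-terms t) (∈-terms u)

allAtoms : ∀ k n → List (Atom k n)
allAtoms k n = termPairs sᵃ ++ termPairs s*ᵃ ++ termPairs _≐ᵃ_ ++ cartesianProductWith Pᵃ (allFin k) (terms n)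

∈-allAtoms : ∀ {k n} (α : Atom k n) → α ∈ allAtoms k n
∈-allAtoms (sᵃ t u) = ∈-++⁺ˡ (∈-termPairs sᵃ t u)
∈-allAtoms (s*ᵃ t u) = ∈-++⁺ʳ (termPairs sᵃ) (∈-++⁺ˡ (∈-termPairs s*ᵃ t u))
∈-allAtoms (t ≐ᵃ u) = ∈-++⁺ʳ (termPairs sᵃ) (∈-++⁺ʳ (termPairs s*ᵃ) (∈-++⁺ˡ (∈-termPairs _≐ᵃ_ t u)))
∈-allAtoms (Pᵃ σ t) = ∈-++⁺ʳ (termPairs sᵃ) (∈-++⁺ʳ (termPairs s*ᵃ) (∈-++⁺ʳ (termPairs _≐ᵃ_)
  (∈-cartesianProductWith⁺ Pᵃ (∈-allFin σ) (∈-terms t))))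

qr : ∀ {k n} → Formula k n → ℕ
qr (s t u) = 0
qr (s* t u) = 0
qr (P σ t) = 0
qr (t ≐ u) = 0
qr ⊥' = 0
qr (¬' φ) = qr φ
qr (φ ∧' ψ) = qr φ ⊔ qr ψ
qr (φ ∨' ψ) = qr φ ⊔ qr ψ
qr (φ ⇒ ψ) = qr φ ⊔ qr ψ
qr (∀' φ) = suc (qr φ)
qr (∃' φ) = suc (qr φ)

SameAtoms : ∀ {k} (M N : Structure k) {n} → (Fin n → Structure.U M) → (Fin n → Structure.U N) → Set
SameAtoms M N ā b̄ = ∀ α → ⟦ M ⟧ (atom α) ā ⇔ ⟦ N ⟧ (atom α) b̄

record BackAndForth {k} (M N : Structure k) : Set₁ where
  private
    module M = Structure M
    module N = Structure N
  field
    Related : ℕ → ∀ {n} → (Fin n → M.U) → (Fin n → N.U) → Set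
    same-atoms : ∀ {q n} {ā : Fin n → M.U} {b̄} → Related q ā b̄ → SameAtoms M N ā b̄
    forth : ∀ {q n} {ā : Fin n → M.U} {b̄} → Related (suc q) ā b̄ →
            ∀ a → Σ N.U λ b → Related q (a ∷ᵉ ā) (b ∷ᵉ b̄)
    back : ∀ {q n} {ā : Fin n → M.U} {b̄} → Related (suc q) ā b̄ →
           ∀ b → Σ M.U λ a → Related q (a ∷ᵉ ā) (b ∷ᵉ b̄)

  ⟦⟧-⇔ : ∀ {q n} (φ : Formula k n) {ā b̄} → Related q ā b̄ → qr φ ℕ.≤ q → ⟦ M ⟧ φ ā ⇔ ⟦ N ⟧ φ b̄
  ⟦⟧-⇔ (s t u) r _ = same-atoms r (sᵃ t u)
  ⟦⟧-⇔ (s* t u) r _ = same-atoms r (s*ᵃ t u)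
  ⟦⟧-⇔ (P σ t) r _ = same-atoms r (Pᵃ σ t)
  ⟦⟧-⇔ (t ≐ u) r _ = same-atoms r (t ≐ᵃ u)
  ⟦⟧-⇔ ⊥' r _ = ⇔-refl
  ⟦⟧-⇔ (¬' φ) r le = ¬-cong-⇔ (⟦⟧-⇔ φ r le)
  ⟦⟧-⇔ (φ ∧' ψ) r le = ⟦⟧-⇔ φ r (m⊔n≤o⇒m≤o _ _ le) ×-cong ⟦⟧-⇔ ψ r (m⊔n≤o⇒n≤o _ _ le)
  ⟦⟧-⇔ (φ ∨' ψ) r le = ⟦⟧-⇔ φ r (m⊔n≤o⇒m≤o _ _ le) ⊎-cong ⟦⟧-⇔ ψ r (m⊔n≤o⇒n≤o _ _ le)
  ⟦⟧-⇔ (φ ⇒ ψ) r le = →-cong-⇔ (⟦⟧-⇔ φ r (m⊔n≤o⇒m≤o _ _ le)) (⟦⟧-⇔ ψ r (m⊔n≤o⇒n≤o _ _ le))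
  ⟦⟧-⇔ (∀' φ) r (s≤s le) = mk⇔
    (λ h b → let a , r′ = back r b in to (⟦⟧-⇔ φ r′ le) (h a))
    (λ h a → let b , r′ = forth r a in from (⟦⟧-⇔ φ r′ le) (h b))
  ⟦⟧-⇔ (∃' φ) r (s≤s le) = mk⇔
    (λ (a , h) → let b , r′ = forth r a in b , to (⟦⟧-⇔ φ r′ le) h)
    (λ (b , h) → let a , r′ = back r b in a , from (⟦⟧-⇔ φ r′ le) h)

-- One-point structures and end extensions

record OnePoint {k} (M : Structure k) (σ : Fin k) : Set where
  open Structure M
  field
    only-zero : ∀ x → x ≡ zeroU
    ¬S-zero : ¬ S zeroU zeroU
    S*-zero : S* zeroU zeroU
    Pr-zero : ∀ τ → Pr τ zeroU ⇔ σ ≡ τ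

pointTruth : ∀ {k n} → Fin k → Atom k n → Set
pointTruth σ (sᵃ _ _) = ⊥
pointTruth σ (s*ᵃ _ _) = ⊤
pointTruth σ (_ ≐ᵃ _) = ⊤
pointTruth σ (Pᵃ τ _) = σ ≡ τ

module _ {k} {M : Structure k} {σ} (X : OnePoint M σ) where
  open Structure M
  open OnePoint X

  ⟦atom⟧-onePoint : ∀ {n} (ā : Fin n → U) α → ⟦ M ⟧ (atom α) ā ⇔ pointTruth σ α
  ⟦atom⟧-onePoint ā (sᵃ t u) = ⇔-trans (resp₂-⇔ S (only-zero _) (only-zero _)) (mk⇔ ¬S-zero λ ())
  ⟦atom⟧-onePoint ā (s*ᵃ t u) = ⇔-trans (resp₂-⇔ S* (only-zero _) (only-zero _)) (mk⇔ _ λ _ → S*-zero)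
  ⟦atom⟧-onePoint ā (t ≐ᵃ u) = ⇔-trans (resp₂-⇔ _≡_ (only-zero _) (only-zero _)) (mk⇔ _ λ _ → refl)
  ⟦atom⟧-onePoint ā (Pᵃ τ t) = ⇔-trans (resp-⇔ (Pr τ) (only-zero _)) (Pr-zero τ)

onePoint-backAndForth : ∀ {k} {M N : Structure k} {σ} → OnePoint M σ → OnePoint N σ → BackAndForth M N
onePoint-backAndForth {M = M} {N} X Y = record
  { Related = λ _ _ _ → ⊤
  ; same-atoms = λ {_} {_} {ā} {b̄} _ α → ⇔-trans (⟦atom⟧-onePoint X ā α) (⇔-sym (⟦atom⟧-onePoint Y b̄ α))
  ; forth = λ _ _ → Structure.zeroU N , tt
  ; back = λ _ _ → Structure.zeroU M , tt
  }

record EndExtension {k} (M M' : Structure k) (σ : Fin k) : Set where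
  private
    module M = Structure M
    module M' = Structure M'
  field
    embed : M.U → M'.U
    new : M'.U
    embed-or-new : ∀ x → x ≡ new ⊎ Σ M.U λ a → x ≡ embed a
    embed-injective : ∀ {a b} → embed a ≡ embed b → a ≡ b
    embed≢new : ∀ {a} → embed a ≢ new
    zero-embed : M'.zeroU ≡ embed M.zeroU
    max-new : M'.maxU ≡ new
    S-embed : ∀ a b → M'.S (embed a) (embed b) ⇔ M.S a b
    S-embed-new : ∀ a → M'.S (embed a) new ⇔ a ≡ M.maxU
    ¬S-new : ∀ x → ¬ M'.S new x
    S*-embed : ∀ a b → M'.S* (embed a) (embed b) ⇔ M.S* a b
    S*-new : ∀ x → M'.S* x new
    ¬S*-new-embed : ∀ a → ¬ M'.S* new (embed a)
    Pr-embed : ∀ τ a → M'.Pr τ (embed a) ⇔ M.Pr τ a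
    Pr-new : ∀ τ → M'.Pr τ new ⇔ σ ≡ τ

  place : Bool → M.U → M'.U
  place true _ = new
  place false a = embed a

  -- ā lies over c̄, except at the positions marked by ν, which hold the new point (and c̄ is junk there).
  Lifted : ∀ {n} → (Fin n → Bool) → (Fin n → M.U) → (Fin n → M'.U) → Set
  Lifted ν c̄ ā = ∀ i → ā i ≡ place (ν i) (c̄ i)

  Lifted-∷ : ∀ {n} {ν : Fin n → Bool} {c̄ ā b c x} → x ≡ place b c → Lifted ν c̄ ā →
             Lifted (b ∷ᵉ ν) (c ∷ᵉ c̄) (x ∷ᵉ ā)
  Lifted-∷ x≡ l zero = x≡
  Lifted-∷ x≡ l (suc i) = l i

isNew : ∀ {n} → (Fin n → Bool) → Term n → Bool
isNew ν (var i) = ν i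
isNew ν c0 = false
isNew ν cmax = true

data Residue (k n : ℕ) : Set₁ where
  fixed : Set → Residue k n
  atomic : Atom k n → Residue k n

⟦_⟧ʳ : ∀ {k n} → Residue k n → (M : Structure k) → (Fin n → Structure.U M) → Set
⟦ fixed A ⟧ʳ M c̄ = A
⟦ atomic α ⟧ʳ M c̄ = ⟦ M ⟧ (atom α) c̄

-- What an atom of an end extension says at a lifted tuple, read off in the base structure.
residue : ∀ {k n} → Fin k → (Fin n → Bool) → Atom k n → Residue k n
residue σ ν (sᵃ t u) with isNew ν t | isNew ν u
... | true | _ = fixed ⊥
... | false | true = atomic (t ≐ᵃ cmax)
... | false | false = atomic (sᵃ t u)
residue σ ν (s*ᵃ t u) with isNew ν t | isNew ν u
... | _ | true = fixed ⊤
... | true | false = fixed ⊥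
... | false | false = atomic (s*ᵃ t u)
residue σ ν (t ≐ᵃ u) with isNew ν t | isNew ν u
... | true | true = fixed ⊤
... | false | false = atomic (t ≐ᵃ u)
... | _ | _ = fixed ⊥
residue σ ν (Pᵃ τ t) with isNew ν t
... | true = fixed (σ ≡ τ)
... | false = atomic (Pᵃ τ t)

residue-cong : ∀ {k n} {M N : Structure k} {c̄ d̄} → SameAtoms M N {n} c̄ d̄ →
               ∀ r → ⟦ r ⟧ʳ M c̄ ⇔ ⟦ r ⟧ʳ N d̄
residue-cong same (fixed A) = ⇔-refl
residue-cong same (atomic α) = same α

module _ {k} {M M' : Structure k} {σ} (X : EndExtension M M' σ) where
  open EndExtension X
  private
    module M = Structure M
    module M' = Structure M'

  evalT-lift : ∀ {n} ν c̄ {ā : Fin n → M'.U} → Lifted ν c̄ ā →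
               ∀ t → evalT M' ā t ≡ place (isNew ν t) (evalT M c̄ t)
  evalT-lift ν c̄ l (var i) = l i
  evalT-lift ν c̄ l c0 = zero-embed
  evalT-lift ν c̄ l cmax = max-new

  ⟦atom⟧-lift : ∀ {n} ν c̄ {ā : Fin n → M'.U} → Lifted ν c̄ ā → ∀ α →
                ⟦ M' ⟧ (atom α) ā ⇔ ⟦ residue σ ν α ⟧ʳ M c̄
  ⟦atom⟧-lift ν c̄ l (sᵃ t u) with isNew ν t | isNew ν u | evalT-lift ν c̄ l t | evalT-lift ν c̄ l u
  ... | true | _ | et | eu = ⇔-trans (resp₂-⇔ M'.S et eu) (mk⇔ (¬S-new _) λ ())
  ... | false | true | et | eu = ⇔-trans (resp₂-⇔ M'.S et eu) (S-embed-new _)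
  ... | false | false | et | eu = ⇔-trans (resp₂-⇔ M'.S et eu) (S-embed _ _)
  ⟦atom⟧-lift ν c̄ l (s*ᵃ t u) with isNew ν t | isNew ν u | evalT-lift ν c̄ l t | evalT-lift ν c̄ l u
  ... | _ | true | et | eu = ⇔-trans (resp₂-⇔ M'.S* et eu) (mk⇔ _ λ _ → S*-new _)
  ... | true | false | et | eu = ⇔-trans (resp₂-⇔ M'.S* et eu) (mk⇔ (¬S*-new-embed _) λ ())
  ... | false | false | et | eu = ⇔-trans (resp₂-⇔ M'.S* et eu) (S*-embed _ _)
  ⟦atom⟧-lift ν c̄ l (t ≐ᵃ u) with isNew ν t | isNew ν u | evalT-lift ν c̄ l t | evalT-lift ν c̄ l u
  ... | true | true | et | eu = ⇔-trans (resp₂-⇔ _≡_ et eu) (mk⇔ _ λ _ → refl)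
  ... | true | false | et | eu = ⇔-trans (resp₂-⇔ _≡_ et eu) (mk⇔ (λ e → embed≢new (sym e)) λ ())
  ... | false | true | et | eu = ⇔-trans (resp₂-⇔ _≡_ et eu) (mk⇔ embed≢new λ ())
  ... | false | false | et | eu = ⇔-trans (resp₂-⇔ _≡_ et eu) (mk⇔ embed-injective (cong embed))
  ⟦atom⟧-lift ν c̄ l (Pᵃ τ t) with isNew ν t | evalT-lift ν c̄ l t
  ... | true | et = ⇔-trans (resp-⇔ (M'.Pr τ) et) (Pr-new τ)
  ... | false | et = ⇔-trans (resp-⇔ (M'.Pr τ) et) (Pr-embed τ _)

-- Word models

snoc : ∀ {A : Set} {n} → (Fin (suc n) → A) → A → Fin (suc (suc n)) → A
snoc w σ i with view i
... | ‵fromℕ = σ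
... | ‵inj₁ {i = j} _ = w j

snoc-inject₁ : ∀ {A : Set} {n} (w : Fin (suc n) → A) σ j → snoc w σ (inject₁ j) ≡ w j
snoc-inject₁ w σ j rewrite view-inject₁ j = refl

snoc-last : ∀ {A : Set} {n} (w : Fin (suc n) → A) σ → snoc w σ (fromℕ (suc n)) ≡ σ
snoc-last {n = n} w σ rewrite view-fromℕ (suc n) = refl

wordModel-onePoint : ∀ {k} (w : Fin 1 → Fin k) → OnePoint (wordModel w) (w zero)
wordModel-onePoint w = record
  { only-zero = λ { zero → refl }
  ; ¬S-zero = λ ()
  ; S*-zero = ℕ.z≤n
  ; Pr-zero = λ τ → ⇔-refl
  }

wordModel-endExtension : ∀ {k n} (w : Fin (suc n) → Fin k) σ → EndExtension (wordModel w) (wordModel (snoc w σ)) σ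
wordModel-endExtension {n = n} w σ = record
  { embed = inject₁
  ; new = fromℕ (suc n)
  ; embed-or-new = embed-or-new
  ; embed-injective = inject₁-injective
  ; embed≢new = λ e → fromℕ≢inject₁ (sym e)
  ; zero-embed = refl
  ; max-new = refl
  ; S-embed = λ a b → resp₂-⇔ (λ x y → x ≡ suc y) (toℕ-inject₁ b) (toℕ-inject₁ a)
  ; S-embed-new = S-embed-new
  ; ¬S-new = ¬S-new
  ; S*-embed = λ a b → resp₂-⇔ ℕ._≤_ (toℕ-inject₁ a) (toℕ-inject₁ b)
  ; S*-new = ≤fromℕ
  ; ¬S*-new-embed = ¬S*-new-embed
  ; Pr-embed = λ τ a → resp-⇔ (_≡ τ) (snoc-inject₁ w σ a)
  ; Pr-new = λ τ → resp-⇔ (_≡ τ) (snoc-last w σ)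
  }
  where
  embed-or-new : ∀ x → x ≡ fromℕ (suc n) ⊎ Σ (Fin (suc n)) λ a → x ≡ inject₁ a
  embed-or-new x with view x
  ... | ‵fromℕ = inj₁ refl
  ... | ‵inj₁ {i = a} _ = inj₂ (a , refl)
  S-embed-new : ∀ a → toℕ (fromℕ (suc n)) ≡ suc (toℕ (inject₁ a)) ⇔ a ≡ fromℕ n
  S-embed-new a = ⇔-trans (resp₂-⇔ (λ x y → suc x ≡ suc y) refl (toℕ-inject₁ a))
    (mk⇔ (λ e → sym (toℕ-injective (suc-injective e))) (λ e → cong (λ x → ℕ.suc (toℕ x)) (sym e)))
  ¬S-new : ∀ x → toℕ x ≢ suc (toℕ (fromℕ (suc n)))
  ¬S-new x e = <⇒≢ (toℕ<n x) (trans e (cong (λ m → ℕ.suc (ℕ.suc m)) (toℕ-fromℕ n)))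
  ¬S*-new-embed : ∀ a → ¬ fromℕ (suc n) Fin.≤ inject₁ a
  ¬S*-new-embed a le = <⇒≱ (inject₁ℕ< a) (subst (ℕ._≤ toℕ (inject₁ a)) (toℕ-fromℕ (suc n)) le)

-- Rank-q types and Hintikka formulas

allVecs : ∀ m → List (Vec Bool m)
allVecs zero = [] ∷ []
allVecs (suc m) = cartesianProductWith _∷_ (true ∷ false ∷ []) (allVecs m)

∈-allVecs : ∀ {m} (v : Vec Bool m) → v ∈ allVecs m
∈-allVecs [] = here refl
∈-allVecs (b ∷ v) = ∈-cartesianProductWith⁺ _∷_ (∈-bools b) (∈-allVecs v)
  where
  ∈-bools : ∀ b → b ∈ true ∷ false ∷ []
  ∈-bools true = here refl
  ∈-bools false = there (here refl)

module QTypes (LEM : (A : Set) → A ⊎ ¬ A) (k : ℕ) where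

  -- Excluded middle turns truth values into booleans, so that types become finite, enumerable data.
  dec : (A : Set) → Dec A
  dec A = fromSum (LEM A)

  does-≡⇒ : {A B : Set} → does (dec A) ≡ does (dec B) → A → B
  does-≡⇒ {A} {B} e a with dec B | trans (sym (dec-true (dec A) a)) e
  ... | yes b | _ = b
  ... | no _ | ()

  charVec : {A : Set} (L : List A) → (A → Set) → Vec Bool (length L)
  charVec [] Q = []
  charVec (x ∷ L) Q = does (dec (Q x)) ∷ charVec L Q

  charVec-≡⇒ : {A : Set} {L : List A} {Q R : A → Set} → charVec L Q ≡ charVec L R →
               ∀ {x} → x ∈ L → Q x → R x
  charVec-≡⇒ e (here refl) q = does-≡⇒ (proj₁ (∷-injective e)) q
  charVec-≡⇒ e (there x∈L) q = charVec-≡⇒ (proj₂ (∷-injective e)) x∈L q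

  charVec-cong : {A : Set} (L : List A) {Q R : A → Set} → (∀ {x} → x ∈ L → Q x ⇔ R x) →
                 charVec L Q ≡ charVec L R
  charVec-cong [] e = refl
  charVec-cong (x ∷ L) e =
    cong₂ _∷_ (does-⇔ (e (here refl)) (dec _) (dec _)) (charVec-cong L λ x∈L → e (there x∈L))

  mutual
    Type : ℕ → ℕ → Set
    Type zero n = Vec Bool (length (allAtoms k n))
    Type (suc q) n = Vec Bool (length (allAtoms k n)) × Vec Bool (length (allTypes q (suc n)))

    allTypes : ∀ q n → List (Type q n)
    allTypes zero n = allVecs _
    allTypes (suc q) n = cartesianProduct (allVecs _) (allVecs _)

  ∈-allTypes : ∀ q {n} (t : Type q n) → t ∈ allTypes q n
  ∈-allTypes zero t = ∈-allVecs t
  ∈-allTypes (suc q) (t₀ , t₁) = ∈-cartesianProduct⁺ (∈-allVecs t₀) (∈-allVecs t₁)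

  module _ (M : Structure k) where
    open Structure M

    atomicType : ∀ {n} → (Fin n → U) → Vec Bool (length (allAtoms k n))
    atomicType {n} ā = charVec (allAtoms k n) λ α → ⟦ M ⟧ (atom α) ā

    tp : ∀ q {n} → (Fin n → U) → Type q n
    tp zero ā = atomicType ā
    tp (suc q) {n} ā = atomicType ā , charVec (allTypes q (suc n)) λ t → Σ U λ a → tp q (a ∷ᵉ ā) ≡ t

  tp∅ : Structure k → ∀ q → Type q 0
  tp∅ M q = tp M q (emptyEnv M)

  signed : ∀ {n} → Formula k n → Bool → Formula k n
  signed φ true = φ
  signed φ false = ¬' φ

  ⋀± : ∀ {n} {A : Set} (L : List A) → (A → Formula k n) → Vec Bool (length L) → Formula k n
  ⋀± [] f [] = ⊤'
  ⋀± (x ∷ L) f (b ∷ bs) = signed (f x) b ∧' ⋀± L f bs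

  hintikka : ∀ q {n} → Type q n → Formula k n
  hintikka zero {n} t = ⋀± (allAtoms k n) atom t
  hintikka (suc q) {n} (t₀ , t₁) =
    ⋀± (allAtoms k n) atom t₀ ∧' ⋀± (allTypes q (suc n)) (λ t → ∃' (hintikka q t)) t₁

  module _ (M : Structure k) where
    open Structure M

    ⟦signed⟧ : ∀ {n} (φ : Formula k n) b {η : Fin n → U} →
               ⟦ M ⟧ (signed φ b) η ⇔ (does (dec (⟦ M ⟧ φ η)) ≡ b)
    ⟦signed⟧ φ true {η} with dec (⟦ M ⟧ φ η)
    ... | yes p = mk⇔ (λ _ → refl) (λ _ → p)
    ... | no ¬p = mk⇔ (λ p → ⊥-elim (¬p p)) λ ()
    ⟦signed⟧ φ false {η} with dec (⟦ M ⟧ φ η)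
    ... | yes p = mk⇔ (λ ¬p → ⊥-elim (¬p p)) λ ()
    ... | no ¬p = mk⇔ (λ _ → refl) (λ _ → ¬p)

    ⟦⋀±⟧ : ∀ {n} {A : Set} (L : List A) (f : A → Formula k n) bs {η : Fin n → U} →
           ⟦ M ⟧ (⋀± L f bs) η ⇔ (charVec L (λ x → ⟦ M ⟧ (f x) η) ≡ bs)
    ⟦⋀±⟧ [] f [] = mk⇔ (λ _ → refl) (λ _ ())
    ⟦⋀±⟧ (x ∷ L) f (b ∷ bs) =
      ⇔-trans (⟦signed⟧ (f x) b ×-cong ⟦⋀±⟧ L f bs) (mk⇔ (uncurry (cong₂ _∷_)) ∷-injective)

    ⟦hintikka⟧ : ∀ q {n} (t : Type q n) (ā : Fin n → U) → ⟦ M ⟧ (hintikka q t) ā ⇔ (tp M q ā ≡ t)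
    ⟦hintikka⟧ zero t ā = ⟦⋀±⟧ _ atom t
    ⟦hintikka⟧ (suc q) (t₀ , t₁) ā =
      ⇔-trans (⟦⋀±⟧ _ atom t₀ ×-cong ⇔-trans (⟦⋀±⟧ _ _ t₁) (resp-⇔ (_≡ t₁) extensions-agree))
              (↔⇒⇔ ×-≡,≡↔≡)
      where
      extensions-agree : charVec (allTypes q _) (λ t → Σ U λ a → ⟦ M ⟧ (hintikka q t) (a ∷ᵉ ā))
                       ≡ charVec (allTypes q _) (λ t → Σ U λ a → tp M q (a ∷ᵉ ā) ≡ t)
      extensions-agree = charVec-cong _ λ {t} _ → Σ-cong-⇔ λ a → ⟦hintikka⟧ q t (a ∷ᵉ ā)

  module _ {M N : Structure k} {n} {ā : Fin n → Structure.U M} {b̄ : Fin n → Structure.U N} where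

    atomicType-≡⇒SameAtoms : atomicType M ā ≡ atomicType N b̄ → SameAtoms M N ā b̄
    atomicType-≡⇒SameAtoms e α = mk⇔ (charVec-≡⇒ e (∈-allAtoms α)) (charVec-≡⇒ (sym e) (∈-allAtoms α))

    SameAtoms⇒atomicType-≡ : SameAtoms M N ā b̄ → atomicType M ā ≡ atomicType N b̄
    SameAtoms⇒atomicType-≡ same = charVec-cong (allAtoms k n) λ {α} _ → same α

    tp-≡⇒SameAtoms : ∀ q → tp M q ā ≡ tp N q b̄ → SameAtoms M N ā b̄
    tp-≡⇒SameAtoms zero e = atomicType-≡⇒SameAtoms e
    tp-≡⇒SameAtoms (suc q) e = atomicType-≡⇒SameAtoms (cong proj₁ e)

    tp-forth : ∀ {q} → tp M (suc q) ā ≡ tp N (suc q) b̄ →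
               ∀ a → Σ (Structure.U N) λ b → tp M q (a ∷ᵉ ā) ≡ tp N q (b ∷ᵉ b̄)
    tp-forth {q} e a with charVec-≡⇒ (cong proj₂ e) (∈-allTypes q (tp M q (a ∷ᵉ ā))) (a , refl)
    ... | b , e′ = b , sym e′

  tp-backAndForth : (M N : Structure k) → BackAndForth M N
  tp-backAndForth M N = record
    { Related = λ q ā b̄ → tp M q ā ≡ tp N q b̄
    ; same-atoms = λ {q} → tp-≡⇒SameAtoms q
    ; forth = tp-forth
    ; back = λ e b → let a , e′ = tp-forth (sym e) b in a , sym e′
    }

  BackAndForth⇒tp-≡ : ∀ {M N : Structure k} (bf : BackAndForth M N) q {n ā b̄} →
                      BackAndForth.Related bf q {n} ā b̄ → tp M q ā ≡ tp N q b̄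
  BackAndForth⇒tp-≡ bf zero r = SameAtoms⇒atomicType-≡ (same-atoms r)
    where open BackAndForth bf
  BackAndForth⇒tp-≡ bf (suc q) r = cong₂ _,_ (SameAtoms⇒atomicType-≡ (same-atoms r)) (charVec-cong _ λ _ → mk⇔
      (λ (a , e) → let b , r′ = forth r a in b , trans (sym (BackAndForth⇒tp-≡ bf q r′)) e)
      (λ (b , e) → let a , r′ = back r b in a , trans (BackAndForth⇒tp-≡ bf q r′) e))
    where open BackAndForth bf

  module _ {M M' N N' : Structure k} {σ} (X : EndExtension M M' σ) (Y : EndExtension N N' σ) where
    private
      module X = EndExtension X
      module Y = EndExtension Y
      module M = Structure M
      module N = Structure N
      module M' = Structure M'
      module N' = Structure N'

    Matched : ℕ → ∀ {n} → (Fin n → M'.U) → (Fin n → N'.U) → Set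
    Matched q {n} ā b̄ = Σ (Fin n → Bool) λ ν → Σ (Fin n → M.U) λ c̄ → Σ (Fin n → N.U) λ d̄ →
                        tp M q c̄ ≡ tp N q d̄ × X.Lifted ν c̄ ā × Y.Lifted ν d̄ b̄

    Matched-forth : ∀ {q n} {ā : Fin n → M'.U} {b̄} → Matched (suc q) ā b̄ →
                    ∀ x → Σ N'.U λ y → Matched q (x ∷ᵉ ā) (y ∷ᵉ b̄)
    Matched-forth (ν , c̄ , d̄ , e , l₁ , l₂) x with X.embed-or-new x
    ... | inj₁ x≡new = let d , e′ = tp-forth e M.zeroU in
      Y.new , true ∷ᵉ ν , M.zeroU ∷ᵉ c̄ , d ∷ᵉ d̄ , e′ , X.Lifted-∷ x≡new l₁ , Y.Lifted-∷ refl l₂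
    ... | inj₂ (a , x≡a) = let d , e′ = tp-forth e a in
      Y.embed d , false ∷ᵉ ν , a ∷ᵉ c̄ , d ∷ᵉ d̄ , e′ , X.Lifted-∷ x≡a l₁ , Y.Lifted-∷ refl l₂

    Matched-back : ∀ {q n} {ā : Fin n → M'.U} {b̄} → Matched (suc q) ā b̄ →
                   ∀ y → Σ M'.U λ x → Matched q (x ∷ᵉ ā) (y ∷ᵉ b̄)
    Matched-back (ν , c̄ , d̄ , e , l₁ , l₂) y with Y.embed-or-new y
    ... | inj₁ y≡new = let c , e′ = tp-forth (sym e) N.zeroU in
      X.new , true ∷ᵉ ν , c ∷ᵉ c̄ , N.zeroU ∷ᵉ d̄ , sym e′ , X.Lifted-∷ refl l₁ , Y.Lifted-∷ y≡new l₂
    ... | inj₂ (b , y≡b) = let c , e′ = tp-forth (sym e) b in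
      X.embed c , false ∷ᵉ ν , c ∷ᵉ c̄ , b ∷ᵉ d̄ , sym e′ , X.Lifted-∷ refl l₁ , Y.Lifted-∷ y≡b l₂

    endExtension-backAndForth : BackAndForth M' N'
    endExtension-backAndForth = record
      { Related = Matched
      ; same-atoms = λ { {q} (ν , c̄ , d̄ , e , l₁ , l₂) α →
          ⇔-trans (⟦atom⟧-lift X ν c̄ l₁ α) (⇔-trans (residue-cong (tp-≡⇒SameAtoms q e) (residue σ ν α))
                                                   (⇔-sym (⟦atom⟧-lift Y ν d̄ l₂ α))) }
      ; forth = Matched-forth
      ; back = Matched-back
      }

    tp-endExtension : ∀ q → tp∅ M q ≡ tp∅ N q → tp∅ M' q ≡ tp∅ N' q
    tp-endExtension q e =
      BackAndForth⇒tp-≡ endExtension-backAndForth q ((λ ()) , emptyEnv M , emptyEnv N , e , (λ ()) , (λ ()))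

-- Initial segments of a model

relT : ∀ {n m} → (Fin n → Fin m) → Fin m → Term n → Term m
relT ρ ξ (var i) = var (ρ i)
relT ρ ξ c0 = c0
relT ρ ξ cmax = var ξ

relativize : ∀ {k n m} → (Fin n → Fin m) → Fin m → Formula k n → Formula k m
relativize ρ ξ (s t u) = s (relT ρ ξ t) (relT ρ ξ u)
relativize ρ ξ (s* t u) = s* (relT ρ ξ t) (relT ρ ξ u)
relativize ρ ξ (P σ t) = P σ (relT ρ ξ t)
relativize ρ ξ (t ≐ u) = relT ρ ξ t ≐ relT ρ ξ u
relativize ρ ξ ⊥' = ⊥'
relativize ρ ξ (¬' φ) = ¬' relativize ρ ξ φ
relativize ρ ξ (φ ∧' ψ) = relativize ρ ξ φ ∧' relativize ρ ξ ψ
relativize ρ ξ (φ ∨' ψ) = relativize ρ ξ φ ∨' relativize ρ ξ ψ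
relativize ρ ξ (φ ⇒ ψ) = relativize ρ ξ φ ⇒ relativize ρ ξ ψ
relativize ρ ξ (∀' φ) = ∀' (s* (var zero) (var (suc ξ)) ⇒ relativize (ext ρ) (suc ξ) φ)
relativize ρ ξ (∃' φ) = ∃' (s* (var zero) (var (suc ξ)) ∧' relativize (ext ρ) (suc ξ) φ)

module Segments (LEM : (A : Set) → A ⊎ ¬ A) {k : ℕ} (B : Structure k)
                (Γ⊨ : ∀ ψ → InΓ ψ → B ⊨ ψ) (A⊨ : B ⊨ AΣw) where
  open Structure B
  open ModelOfΓ B Γ⊨ A⊨
  open QTypes LEM k

  -- Membership is stored as True (dec …), which is proof-irrelevant, so an element of a segment is
  -- determined by its first component (segment-≡).
  segment : U → Structure k
  segment x = record
    { U = Σ U λ y → True (dec (S* y x))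
    ; zeroU = zeroU , fromWitness (zero-S* x)
    ; maxU = x , fromWitness (S*-refl x)
    ; S = λ a b → S (proj₁ a) (proj₁ b)
    ; S* = λ a b → S* (proj₁ a) (proj₁ b)
    ; Pr = λ τ a → Pr τ (proj₁ a)
    }

  segment-≡ : ∀ {x} {a b : Structure.U (segment x)} → proj₁ a ≡ proj₁ b → a ≡ b
  segment-≡ {a = y , p} {.y , p′} refl = cong (y ,_) (T-irrelevant p p′)

  segment-endExtension : ∀ {u v} → S u v → EndExtension (segment u) (segment v) (label v)
  segment-endExtension {u} {v} uv = record
    { embed = λ (y , p) → y , fromWitness (S*-trans (toWitness p) (S⇒S* uv))
    ; new = v , fromWitness (S*-refl v)
    ; embed-or-new = embed-or-new
    ; embed-injective = λ e → segment-≡ (cong proj₁ e)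
    ; embed≢new = λ { {y , p} e → S-acyclic uv (subst (λ z → S* z u) (cong proj₁ e) (toWitness p)) }
    ; zero-embed = segment-≡ refl
    ; max-new = refl
    ; S-embed = λ _ _ → ⇔-refl
    ; S-embed-new = λ _ → mk⇔ (λ yv → segment-≡ (S-injectiveˡ yv uv)) (λ { refl → uv })
    ; ¬S-new = λ (y , p) vy → S-acyclic vy (toWitness p)
    ; S*-embed = λ _ _ → ⇔-refl
    ; S*-new = λ (y , p) → toWitness p
    ; ¬S*-new-embed = λ (y , p) vy → S-acyclic uv (S*-trans vy (toWitness p))
    ; Pr-embed = λ _ _ → ⇔-refl
    ; Pr-new = λ τ → Pr⇔label τ v
    }
    where
    embed-or-new : ∀ (a : Structure.U (segment v)) →
                   a ≡ (v , fromWitness (S*-refl v)) ⊎ Σ (Structure.U (segment u)) λ b →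
                     a ≡ (proj₁ b , fromWitness (S*-trans (toWitness (proj₂ b)) (S⇒S* uv)))
    embed-or-new (y , p) with S*-into-successor (toWitness p) uv
    ... | inj₁ y≡v = inj₁ (segment-≡ y≡v)
    ... | inj₂ yu = inj₂ ((y , fromWitness yu) , segment-≡ refl)

  segment-zero-onePoint : OnePoint (segment zeroU) (label zeroU)
  segment-zero-onePoint = record
    { only-zero = λ (y , p) → segment-≡ (S*-zero (toWitness p))
    ; ¬S-zero = S-irrefl
    ; S*-zero = S*-refl zeroU
    ; Pr-zero = λ τ → Pr⇔label τ zeroU
    }

  segment-max-backAndForth : BackAndForth (segment maxU) B
  segment-max-backAndForth = record
    { Related = λ _ ā b̄ → ∀ i → proj₁ (ā i) ≡ b̄ i
    ; same-atoms = same-atoms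
    ; forth = λ r a → proj₁ a , λ { zero → refl ; (suc i) → r i }
    ; back = λ r b → (b , fromWitness (S*-max b)) , λ { zero → refl ; (suc i) → r i }
    }
    where
    same-atoms : ∀ {n} {ā : Fin n → Structure.U (segment maxU)} {b̄} → (∀ i → proj₁ (ā i) ≡ b̄ i) →
                 SameAtoms (segment maxU) B ā b̄
    same-atoms {ā = ā} {b̄} r = λ where
        (sᵃ t u) → resp₂-⇔ S (ev t) (ev u)
        (s*ᵃ t u) → resp₂-⇔ S* (ev t) (ev u)
        (t ≐ᵃ u) → ⇔-trans (mk⇔ (cong proj₁) segment-≡) (resp₂-⇔ _≡_ (ev t) (ev u))
        (Pᵃ τ t) → resp-⇔ (Pr τ) (ev t)
      where
      ev : ∀ t → proj₁ (evalT (segment maxU) ā t) ≡ evalT B b̄ t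
      ev (var i) = r i
      ev c0 = refl
      ev cmax = refl

  module _ (x : U) where
    private
      Uₓ : Set
      Uₓ = Structure.U (segment x)

    evalT-relT : ∀ {n m} (ρ : Fin n → Fin m) ξ {η : Fin m → U} {ā : Fin n → Uₓ} →
                 η ξ ≡ x → (∀ i → η (ρ i) ≡ proj₁ (ā i)) →
                 ∀ t → evalT B η (relT ρ ξ t) ≡ proj₁ (evalT (segment x) ā t)
    evalT-relT ρ ξ ξ↦x r (var i) = r i
    evalT-relT ρ ξ ξ↦x r c0 = refl
    evalT-relT ρ ξ ξ↦x r cmax = ξ↦x

    ⟦relativize⟧ : ∀ {n m} (ρ : Fin n → Fin m) ξ (φ : Formula k n) {η : Fin m → U} {ā : Fin n → Uₓ} →
                   η ξ ≡ x → (∀ i → η (ρ i) ≡ proj₁ (ā i)) → ⟦ B ⟧ (relativize ρ ξ φ) η ⇔ ⟦ segment x ⟧ φ ā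

    ⟦relativize⟧-∷ : ∀ {n m} (ρ : Fin n → Fin m) ξ (φ : Formula k (suc n)) {η : Fin m → U} {ā : Fin n → Uₓ} →
                     η ξ ≡ x → (∀ i → η (ρ i) ≡ proj₁ (ā i)) → ∀ a →
                     ⟦ B ⟧ (relativize (ext ρ) (suc ξ) φ) (proj₁ a ∷ᵉ η) ⇔ ⟦ segment x ⟧ φ (a ∷ᵉ ā)

    ⟦relativize⟧ ρ ξ (s t u) ξ↦x r = resp₂-⇔ S (evalT-relT ρ ξ ξ↦x r t) (evalT-relT ρ ξ ξ↦x r u)
    ⟦relativize⟧ ρ ξ (s* t u) ξ↦x r = resp₂-⇔ S* (evalT-relT ρ ξ ξ↦x r t) (evalT-relT ρ ξ ξ↦x r u)
    ⟦relativize⟧ ρ ξ (P σ t) ξ↦x r = resp-⇔ (Pr σ) (evalT-relT ρ ξ ξ↦x r t)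
    ⟦relativize⟧ ρ ξ (t ≐ u) ξ↦x r =
      ⇔-trans (resp₂-⇔ _≡_ (evalT-relT ρ ξ ξ↦x r t) (evalT-relT ρ ξ ξ↦x r u)) (mk⇔ segment-≡ (cong proj₁))
    ⟦relativize⟧ ρ ξ ⊥' ξ↦x r = ⇔-refl
    ⟦relativize⟧ ρ ξ (¬' φ) ξ↦x r = ¬-cong-⇔ (⟦relativize⟧ ρ ξ φ ξ↦x r)
    ⟦relativize⟧ ρ ξ (φ ∧' ψ) ξ↦x r = ⟦relativize⟧ ρ ξ φ ξ↦x r ×-cong ⟦relativize⟧ ρ ξ ψ ξ↦x r
    ⟦relativize⟧ ρ ξ (φ ∨' ψ) ξ↦x r = ⟦relativize⟧ ρ ξ φ ξ↦x r ⊎-cong ⟦relativize⟧ ρ ξ ψ ξ↦x r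
    ⟦relativize⟧ ρ ξ (φ ⇒ ψ) ξ↦x r = →-cong-⇔ (⟦relativize⟧ ρ ξ φ ξ↦x r) (⟦relativize⟧ ρ ξ ψ ξ↦x r)
    ⟦relativize⟧ ρ ξ (∀' φ) ξ↦x r = mk⇔
      (λ h (y , p) → to (⟦relativize⟧-∷ ρ ξ φ ξ↦x r (y , p)) (h y (subst (S* y) (sym ξ↦x) (toWitness p))))
      (λ h y yx → from (⟦relativize⟧-∷ ρ ξ φ ξ↦x r (y , fromWitness (subst (S* y) ξ↦x yx))) (h _))
    ⟦relativize⟧ ρ ξ (∃' φ) ξ↦x r = mk⇔
      (λ (y , yx , h) → (y , fromWitness (subst (S* y) ξ↦x yx)) , to (⟦relativize⟧-∷ ρ ξ φ ξ↦x r _) h)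
      (λ ((y , p) , h) → y , subst (S* y) (sym ξ↦x) (toWitness p) , from (⟦relativize⟧-∷ ρ ξ φ ξ↦x r (y , p)) h)

    ⟦relativize⟧-∷ ρ ξ φ ξ↦x r a = ⟦relativize⟧ (ext ρ) (suc ξ) φ ξ↦x λ { zero → refl ; (suc i) → r i }

  IsWordType : ∀ q → Type q 0 → Set
  IsWordType q t = Σ ℕ λ n → Σ (Fin (suc n) → Fin k) λ w → tp∅ (wordModel w) q ≡ t

  isWordType? : ∀ q t → Dec (IsWordType q t)
  isWordType? q t = dec (IsWordType q t)

  segmentHasWordType : ℕ → Formula k 1
  segmentHasWordType q =
    ⋁ (mapL (λ t → relativize (λ ()) zero (hintikka q t)) (filter (isWordType? q) (allTypes q 0)))

  ⟦segmentHasWordType⟧ : ∀ q x → ⟦ B ⟧ (segmentHasWordType q) (x ∷ᵉ ∅) ⇔ IsWordType q (tp∅ (segment x) q)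
  ⟦segmentHasWordType⟧ q x = mk⇔
    (λ h → let t , t∈ , ht = ⟦⋁⟧⁻ B _ (filter (isWordType? q) (allTypes q 0)) h in
           subst (IsWordType q) (sym (to (⟦hintikka⟧-segment t) ht))
                 (proj₂ (∈-filter⁻ (isWordType? q) {xs = allTypes q 0} t∈)))
    (λ isWord → ⟦⋁⟧⁺ B _ (∈-filter⁺ (isWordType? q) (∈-allTypes q _) isWord) (from (⟦hintikka⟧-segment _) refl))
    where
    ⟦hintikka⟧-segment : ∀ t → ⟦ B ⟧ (relativize (λ ()) zero (hintikka q t)) (x ∷ᵉ ∅) ⇔ (tp∅ (segment x) q ≡ t)
    ⟦hintikka⟧-segment t =
      ⇔-trans (⟦relativize⟧ x (λ ()) zero (hintikka q t) refl (λ ())) (⟦hintikka⟧ (segment x) q t _)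

  segment-IsWordType : ∀ q x → IsWordType q (tp∅ (segment x) q)
  segment-IsWordType q x = to (⟦segmentHasWordType⟧ q x) (⟦Ind⟧ B Z Q ∅ (ind Z Q ∅) base step refl (zero-S* x))
    where
    Z Q : Formula k 1
    Z = var zero ≐ c0
    Q = segmentHasWordType q
    base : ∀ w → w ≡ zeroU → ⟦ B ⟧ Q (w ∷ᵉ ∅)
    base w refl = from (⟦segmentHasWordType⟧ q zeroU)
      (0 , letter₀ , BackAndForth⇒tp-≡ (onePoint-backAndForth (wordModel-onePoint letter₀) segment-zero-onePoint) q tt)
      where
      letter₀ : Fin 1 → Fin k
      letter₀ _ = label zeroU
    step : ∀ u v → ⟦ B ⟧ Q (u ∷ᵉ ∅) → S u v → ⟦ B ⟧ Q (v ∷ᵉ ∅)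
    step u v Qu uv with to (⟦segmentHasWordType⟧ q u) Qu
    ... | n , w , e = from (⟦segmentHasWordType⟧ q v)
      (suc n , snoc w (label v) , tp-endExtension (wordModel-endExtension w (label v)) (segment-endExtension uv) q e)

lemma4p10 : (LEM : (A : Set) → A ⊎ ¬ A) →
    (k : ℕ) (φ : Sentence k) (B : Structure k) →
    (∀ ψ → InΓ ψ → B ⊨ ψ) → B ⊨ AΣw → B ⊨ φ →
    Σ ℕ λ n → Σ (Fin (suc n) → Fin k) λ w → wordModel w ⊨ φ
lemma4p10 LEM k φ B Γ⊨ A⊨ B⊨φ = fromWordType (segment-IsWordType (qr φ) maxU)
  where
  open Structure B using (maxU)
  open QTypes LEM k
  open Segments LEM B Γ⊨ A⊨
  segment-max⊨φ : segment maxU ⊨ φ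
  segment-max⊨φ = from (BackAndForth.⟦⟧-⇔ segment-max-backAndForth φ (λ ()) ≤-refl) B⊨φ
  fromWordType : IsWordType (qr φ) (tp∅ (segment maxU) (qr φ)) →
                 Σ ℕ λ n → Σ (Fin (suc n) → Fin k) λ w → wordModel w ⊨ φ
  fromWordType (n , w , e) =
    n , w , from (BackAndForth.⟦⟧-⇔ (tp-backAndForth (wordModel w) (segment maxU)) φ e ≤-refl) segment-max⊨φ
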